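{- Let $n$ be a positive integer and $m\ge 2n$ an integer. For every $n$-element set $X\subset[m]$, the expected maxload of $\mathcal{R}\mathsf{H}_m$ on $X$ is at most $\max_{k\in[m/2,m]\cap\mathbb{Z}} 2M_{\mathsf{SH}}(k,n)$.
   Context: $[N]=\{0,\dots,N-1\}$; for positive integer $N$, $\mathfrak{m}_N(x)$ is the unique element of $(x+N\mathbb{Z})\cap[0,N)$; $\mathbb{Z}_N^{\times}$ is the set of $k\in[N]$ coprime to $N$. There are $n$ bins. $\mathsf{SH}_k$: choose $c$ uniformly from $\mathbb{Z}_k^{\times}$ and place $x$ in bin $\lfloor\mathfrak{m}_k(cx)/(k/n)\rfloor$; $M_{\mathsf{SH}}(k,n)$ is the maximum over $n$-element $X\subset[k]$ of its expected maxload on $X$. $\mathcal{R}\mathsf{H}_m$: choose an integer $k$ uniformly from $[m/2,m]\cap\mathbb{Z}$, then hash with $\mathsf{SH}_k$'s hash function. The maxload on $X$ is the number of elements of $X$ in the fullest bin. -}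

module Defs where

open import Data.Nat as ℕ using (ℕ; zero; suc; _+_; _*_; _≤?_; _≟_)
open import Data.Nat.DivMod using (_/_; _%_)
open import Data.Nat.GCD using (gcd)
open import Data.List using (List; []; _∷_; length; map; filter; upTo; foldr; _++_)
open import Data.Nat.ListAction using (sum)
open import Data.Integer using (+_)
open import Data.Rational as ℚ using (ℚ; 0ℚ; _⊔_)

maxℚ : List ℚ → ℚ
maxℚ = foldr _⊔_ 0ℚ

maxℕ : List ℕ → ℕ
maxℕ = foldr ℕ._⊔_ 0

-- average of a list of naturals (uniform expectation); 0 for the empty list
avg : List ℕ → ℚ
avg [] = 0ℚ
avg (x ∷ xs) = (+ sum (x ∷ xs)) ℚ./ length (x ∷ xs)

units : ℕ → List ℕ
units k = filter (λ c → gcd c k ≟ 1) (upTo k)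

-- bin of x under SH_k with multiplier c and n bins:
-- ⌊ m_k(c x) / (k/n) ⌋ = ⌊ n · (c x mod k) / k ⌋
binOf : (n k c x : ℕ) → ℕ
binOf n zero c x = 0
binOf n (suc k) c x = (n * ((c * x) % suc k)) / suc k

load : (n k c : ℕ) → List ℕ → ℕ → ℕ
load n k c X b = length (filter (λ x → binOf n k c x ≟ b) X)

maxload : (n k c : ℕ) → List ℕ → ℕ
maxload n k c X = maxℕ (map (load n k c X) (upTo n))

expSH : (n k : ℕ) → List ℕ → ℚ
expSH n k X = avg (map (λ c → maxload n k c X) (units k))

powerset : List ℕ → List (List ℕ)
powerset [] = [] ∷ []
powerset (x ∷ xs) = map (x ∷_) (powerset xs) ++ powerset xs

subsetsOfSize : (k n : ℕ) → List (List ℕ)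
subsetsOfSize k n = filter (λ s → length s ≟ n) (powerset (upTo k))

M-SH : (k n : ℕ) → ℚ
M-SH k n = maxℚ (map (expSH n k) (subsetsOfSize k n))

range : ℕ → List ℕ
range m = filter (λ k → m ≤? 2 * k) (upTo (suc m))

expRH : (n m : ℕ) → List ℕ → ℚ
expRH n m X = avg-ℚ (map (λ k → expSH n k X) (range m))
  where
  sumℚ : List ℚ → ℚ
  sumℚ = foldr ℚ._+_ 0ℚ
  avg-ℚ : List ℚ → ℚ
  avg-ℚ [] = 0ℚ
  avg-ℚ (q ∷ qs) = sumℚ (q ∷ qs) ℚ.* (+ 1 ℚ./ length (q ∷ qs))

2ℚ : ℚ
2ℚ = + 2 ℚ./ 1

{-# OPTIONS --safe #-}
module Submission where

open import Defs
open import Data.Nat using (ℕ; _≤_; _<_; _*_)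
open import Data.List using (List; length; map)
open import Data.List.Relation.Unary.All using (All)
open import Data.List.Relation.Unary.Unique.Propositional using (Unique)
open import Data.Rational using (ℚ) renaming (_≤_ to _≤ℚ_; _*_ to _*ℚ_)
open import Relation.Binary.PropositionalEquality using (_≡_)

open import Data.Nat as ℕ using (zero; suc; z≤n; s≤s; _+_; _≟_; NonZero)
open import Data.Nat.DivMod using (_/_; _%_; m≡m%n+[m/n]*n; %-distribˡ-*; m%n%n≡m%n; m%n<n; m<n*o⇒m/o<n)
import Data.Nat.Properties as ℕ
open import Data.Nat.ListAction using (sum)
open import Data.Integer as ℤ using (+_; +≤+)
import Data.Integer.Properties as ℤ
open import Data.Integer.Tactic.RingSolver using (solve-∀)
open import Data.Rational as ℚ using (0ℚ; 1ℚ; toℚᵘ)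
import Data.Rational.Properties as ℚ
open import Data.Rational.Unnormalised as ℚᵘ using (mkℚᵘ; *≡*; *≤*)
import Data.Rational.Unnormalised.Properties as ℚᵘ
open import Data.List using ([]; _∷_; foldr; filter; upTo; cartesianProduct; _++_)
open import Data.List.Properties using (length-map; length-++; length-upTo; length-removeAt′)
open import Data.List.Relation.Unary.All using ([]; _∷_)
import Data.List.Relation.Unary.All as All
open import Data.List.Relation.Unary.Any using (here; there; index; _─_)
open import Data.List.Relation.Unary.AllPairs using ([]; _∷_)
import Data.List.Relation.Unary.Unique.Propositional.Properties as Unique
open import Data.List.Membership.Propositional using (_∈_)
open import Data.List.Membership.Propositional.Properties
  using (∈-map⁺; ∈-map⁻; ∈-filter⁺; ∈-filter⁻; ∈-++⁺ˡ; ∈-++⁺ʳ; ∈-upTo⁺; ∈-cartesianProduct⁺)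
open import Data.List.Membership.DecPropositional ℕ._≟_ using (_∈?_)
open import Data.List.Relation.Binary.Subset.Propositional using (_⊆_)
open import Data.Product using (_×_; _,_; proj₁; proj₂; ∃-syntax)
open import Relation.Nullary using (yes; no)
open import Relation.Nullary.Negation using (contradiction)
open import Relation.Binary.PropositionalEquality
  using (_≢_; refl; sym; trans; cong; cong₂; subst; module ≡-Reasoning)

-- Fix k ∈ [m/2, m]. Then X ⊂ [2k], and the bin of x under SH_k depends only on x mod k.
-- Extend the residues of X mod k to an n-element Y ⊂ [k] (possible as n ≤ k). Since
-- x ↦ (x / k, x mod k) is injective, for every multiplier each bin receives at most twice as
-- many elements of X as of Y, so the expected maxload of SH_k on X is at most
-- 2 E[maxload on Y] ≤ 2 M_SH(k, n). Averaging over k, the expectation for RH_m is at most the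
-- largest of these bounds.

private
  variable
    A B : Set

∈-─ : ∀ {x y : A} {ys} (x∈ys : x ∈ ys) → y ∈ ys → y ≢ x → y ∈ (ys ─ x∈ys)
∈-─ (here refl) (here refl) y≢x = contradiction refl y≢x
∈-─ (here refl) (there y∈ys) _  = y∈ys
∈-─ (there x∈ys) (here refl) _  = here refl
∈-─ (there x∈ys) (there y∈ys) y≢x = there (∈-─ x∈ys y∈ys y≢x)

length-─ : ∀ {x : A} {xs} (x∈xs : x ∈ xs) → length xs ≡ suc (length (xs ─ x∈xs))
length-─ {xs = xs} x∈xs = length-removeAt′ xs (index x∈xs)

Unique-⊆⇒length-≤ : ∀ {xs ys : List A} → Unique xs → xs ⊆ ys → length xs ≤ length ys
Unique-⊆⇒length-≤ {xs = []} _ _ = z≤n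
Unique-⊆⇒length-≤ {xs = x ∷ xs} {ys} (x∉xs ∷ uxs) xxs⊆ys = begin
  suc (length xs)               ≤⟨ s≤s (Unique-⊆⇒length-≤ uxs xs⊆ys─x) ⟩
  suc (length (ys ─ x∈ys))      ≡⟨ length-─ x∈ys ⟨
  length ys                     ∎
  where
  open ℕ.≤-Reasoning
  x∈ys = xxs⊆ys (here refl)
  xs⊆ys─x : xs ⊆ (ys ─ x∈ys)
  xs⊆ys─x y∈xs = ∈-─ x∈ys (xxs⊆ys (there y∈xs)) (λ y≡x → All.lookup x∉xs y∈xs (sym y≡x))

length-cartesianProduct : ∀ (xs : List A) (ys : List B) →
  length (cartesianProduct xs ys) ≡ length xs * length ys
length-cartesianProduct [] ys = refl
length-cartesianProduct (x ∷ xs) ys = begin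
  length (map (x ,_) ys ++ cartesianProduct xs ys)          ≡⟨ length-++ (map (x ,_) ys) ⟩
  length (map (x ,_) ys) + length (cartesianProduct xs ys) ≡⟨ cong₂ _+_ (length-map (x ,_) ys) (length-cartesianProduct xs ys) ⟩
  length ys + length xs * length ys                         ∎
  where open ≡-Reasoning

divMod-injective : ∀ d .{{_ : NonZero d}} {x y} → x / d ≡ y / d → x % d ≡ y % d → x ≡ y
divMod-injective d {x} {y} x/d≡y/d x%d≡y%d = begin
  x                 ≡⟨ m≡m%n+[m/n]*n x d ⟩
  x % d + x / d * d ≡⟨ cong₂ (λ r q → r + q * d) x%d≡y%d x/d≡y/d ⟩
  y % d + y / d * d ≡⟨ m≡m%n+[m/n]*n y d ⟨
  y                 ∎
  where open ≡-Reasoning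

sum-map-≤-* : ∀ q {f g : ℕ → ℕ} cs → (∀ c → f c ≤ q * g c) → sum (map f cs) ≤ q * sum (map g cs)
sum-map-≤-* q []       _ = z≤n
sum-map-≤-* q {f} {g} (c ∷ cs) f≤qg = begin
  f c + sum (map f cs)           ≤⟨ ℕ.+-mono-≤ (f≤qg c) (sum-map-≤-* q cs f≤qg) ⟩
  q * g c + q * sum (map g cs)   ≡⟨ ℕ.*-distribˡ-+ q (g c) (sum (map g cs)) ⟨
  q * (g c + sum (map g cs))     ∎
  where open ℕ.≤-Reasoning

maxℕ-map-≤-* : ∀ q {f g : ℕ → ℕ} bs → (∀ b → f b ≤ q * g b) → maxℕ (map f bs) ≤ q * maxℕ (map g bs)
maxℕ-map-≤-* q []       _ = z≤n
maxℕ-map-≤-* q {f} {g} (b ∷ bs) f≤qg = ℕ.⊔-lub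
  (ℕ.≤-trans (f≤qg b) (ℕ.*-monoʳ-≤ q (ℕ.m≤m⊔n (g b) _)))
  (ℕ.≤-trans (maxℕ-map-≤-* q bs f≤qg) (ℕ.*-monoʳ-≤ q (ℕ.m≤n⊔m (g b) _)))

toℚᵘ-/ : ∀ i l → toℚᵘ (i ℚ./ suc l) ℚᵘ.≃ mkℚᵘ i l
toℚᵘ-/ i l = ℚ.toℚᵘ-fromℚᵘ (mkℚᵘ i l)

a≤q*b⇒a/d≤q*[b/d] : ∀ q {a b} l → a ≤ q * b → + a ℚ./ suc l ≤ℚ (+ q ℚ./ 1) *ℚ (+ b ℚ./ suc l)
a≤q*b⇒a/d≤q*[b/d] q {a} {b} l a≤qb = ℚ.toℚᵘ-cancel-≤ (begin
  toℚᵘ (+ a ℚ./ suc l)                              ≃⟨ toℚᵘ-/ (+ a) l ⟩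
  mkℚᵘ (+ a) l                                      ≤⟨ *≤* cross-multiplied ⟩
  mkℚᵘ (+ q) 0 ℚᵘ.* mkℚᵘ (+ b) l                    ≃⟨ ℚᵘ.*-cong (toℚᵘ-/ (+ q) 0) (toℚᵘ-/ (+ b) l) ⟨
  toℚᵘ (+ q ℚ./ 1) ℚᵘ.* toℚᵘ (+ b ℚ./ suc l)        ≃⟨ ℚ.toℚᵘ-homo-* (+ q ℚ./ 1) (+ b ℚ./ suc l) ⟨
  toℚᵘ ((+ q ℚ./ 1) *ℚ (+ b ℚ./ suc l))            ∎)
  where
  open ℚᵘ.≤-Reasoning
  cross-multiplied : + a ℤ.* + suc (l + 0) ℤ.≤ (+ q ℤ.* + b) ℤ.* + suc l
  cross-multiplied = subst (λ d → + a ℤ.* + suc d ℤ.≤ (+ q ℤ.* + b) ℤ.* + suc l) (sym (ℕ.+-identityʳ l))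
    (ℤ.*-monoʳ-≤-nonNeg (+ suc l) (subst (+ a ℤ.≤_) (ℤ.pos-* q b) (+≤+ a≤qb)))

[1+k]/1≡1+k/1 : ∀ k → + suc k ℚ./ 1 ≡ 1ℚ ℚ.+ + k ℚ./ 1
[1+k]/1≡1+k/1 k = ℚ.toℚᵘ-injective (begin
  toℚᵘ (+ suc k ℚ./ 1)                  ≈⟨ toℚᵘ-/ (+ suc k) 0 ⟩
  mkℚᵘ (+ suc k) 0                      ≈⟨ *≡* (cross-multiplied (+ k)) ⟩
  mkℚᵘ (+ 1) 0 ℚᵘ.+ mkℚᵘ (+ k) 0        ≈⟨ ℚᵘ.+-cong (toℚᵘ-/ (+ 1) 0) (toℚᵘ-/ (+ k) 0) ⟨
  toℚᵘ 1ℚ ℚᵘ.+ toℚᵘ (+ k ℚ./ 1)         ≈⟨ ℚ.toℚᵘ-homo-+ 1ℚ (+ k ℚ./ 1) ⟨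
  toℚᵘ (1ℚ ℚ.+ + k ℚ./ 1)               ∎)
  where
  open ℚᵘ.≃-Reasoning
  cross-multiplied : ∀ i → (+ 1 ℤ.+ i) ℤ.* (+ 1 ℤ.* + 1) ≡ (+ 1 ℤ.* + 1 ℤ.+ i ℤ.* + 1) ℤ.* + 1
  cross-multiplied = solve-∀

[1+l]/1*1/[1+l]≡1 : ∀ l → (+ suc l ℚ./ 1) *ℚ (+ 1 ℚ./ suc l) ≡ 1ℚ
[1+l]/1*1/[1+l]≡1 l = ℚ.toℚᵘ-injective (begin
  toℚᵘ ((+ suc l ℚ./ 1) *ℚ (+ 1 ℚ./ suc l))      ≈⟨ ℚ.toℚᵘ-homo-* (+ suc l ℚ./ 1) (+ 1 ℚ./ suc l) ⟩
  toℚᵘ (+ suc l ℚ./ 1) ℚᵘ.* toℚᵘ (+ 1 ℚ./ suc l) ≈⟨ ℚᵘ.*-cong (toℚᵘ-/ (+ suc l) 0) (toℚᵘ-/ (+ 1) l) ⟩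
  mkℚᵘ (+ suc l) 0 ℚᵘ.* mkℚᵘ (+ 1) l             ≈⟨ ℚᵘ.*-inverseʳ (mkℚᵘ (+ suc l) 0) ⟩
  ℚᵘ.1ℚᵘ                                        ∎)
  where open ℚᵘ.≃-Reasoning

sumℚ : List ℚ → ℚ
sumℚ = foldr ℚ._+_ 0ℚ

sumℚ-≤ : ∀ {M} ps → All (_≤ℚ M) ps → sumℚ ps ≤ℚ (+ length ps ℚ./ 1) *ℚ M
sumℚ-≤ {M} []       []             = ℚ.≤-reflexive (sym (ℚ.*-zeroˡ M))
sumℚ-≤ {M} (p ∷ ps) (p≤M ∷ ps≤M) = begin
  p ℚ.+ sumℚ ps                          ≤⟨ ℚ.+-mono-≤ p≤M (sumℚ-≤ ps ps≤M) ⟩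
  M ℚ.+ (+ length ps ℚ./ 1) *ℚ M          ≡⟨ cong (ℚ._+ (+ length ps ℚ./ 1) *ℚ M) (ℚ.*-identityˡ M) ⟨
  1ℚ *ℚ M ℚ.+ (+ length ps ℚ./ 1) *ℚ M    ≡⟨ ℚ.*-distribʳ-+ M 1ℚ (+ length ps ℚ./ 1) ⟨
  (1ℚ ℚ.+ + length ps ℚ./ 1) *ℚ M         ≡⟨ cong (_*ℚ M) ([1+k]/1≡1+k/1 (length ps)) ⟨
  (+ suc (length ps) ℚ./ 1) *ℚ M          ∎
  where open ℚ.≤-Reasoning

maxℚ-upper : ∀ {p} ps → p ∈ ps → p ≤ℚ maxℚ ps
maxℚ-upper (p ∷ ps) (here refl)  = ℚ.p≤p⊔q p (maxℚ ps)
maxℚ-upper (q ∷ ps) (there p∈ps) = ℚ.p≤q⇒p≤r⊔q q (maxℚ-upper ps p∈ps)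

0≤maxℚ : ∀ ps → 0ℚ ≤ℚ maxℚ ps
0≤maxℚ []       = ℚ.≤-refl
0≤maxℚ (p ∷ ps) = ℚ.p≤q⇒p≤r⊔q p (0≤maxℚ ps)

maxℚ-map-mono : ∀ {F G : ℕ → ℚ} ks → (∀ {k} → k ∈ ks → F k ≤ℚ G k) → maxℚ (map F ks) ≤ℚ maxℚ (map G ks)
maxℚ-map-mono []       _    = ℚ.≤-refl
maxℚ-map-mono (k ∷ ks) F≤G = ℚ.⊔-mono-≤ (F≤G (here refl)) (maxℚ-map-mono ks (λ k∈ks → F≤G (there k∈ks)))

avg-≤-* : ∀ q (as bs : List ℕ) → length as ≡ length bs → sum as ≤ q * sum bs →
  avg as ≤ℚ (+ q ℚ./ 1) *ℚ avg bs
avg-≤-* q []       []       _ _ = ℚ.≤-reflexive (sym (ℚ.*-zeroʳ (+ q ℚ./ 1)))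
avg-≤-* q (a ∷ as) (b ∷ bs) |as|≡|bs| Σa≤qΣb rewrite ℕ.suc-injective |as|≡|bs| =
  a≤q*b⇒a/d≤q*[b/d] q (length bs) Σa≤qΣb

averageℚ : List ℚ → ℚ
averageℚ []       = 0ℚ
averageℚ (p ∷ ps) = sumℚ (p ∷ ps) *ℚ (+ 1 ℚ./ length (p ∷ ps))

averageℚ-≤ : ∀ {M} ps → All (_≤ℚ M) ps → 0ℚ ≤ℚ M → averageℚ ps ≤ℚ M
averageℚ-≤ []       _     0≤M = 0≤M
averageℚ-≤ {M} ps@(_ ∷ ps′) ps≤M _ = begin
  sumℚ ps *ℚ r        ≤⟨ ℚ.*-monoʳ-≤-nonNeg r {{ℚ.normalize-nonNeg 1 (length ps)}} (sumℚ-≤ ps ps≤M) ⟩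
  (|ps| *ℚ M) *ℚ r    ≡⟨ cong (_*ℚ r) (ℚ.*-comm |ps| M) ⟩
  (M *ℚ |ps|) *ℚ r    ≡⟨ ℚ.*-assoc M |ps| r ⟩
  M *ℚ (|ps| *ℚ r)    ≡⟨ cong (M *ℚ_) ([1+l]/1*1/[1+l]≡1 (length ps′)) ⟩
  M *ℚ 1ℚ             ≡⟨ ℚ.*-identityʳ M ⟩
  M                   ∎
  where
  open ℚ.≤-Reasoning
  |ps| = + length ps ℚ./ 1
  r    = + 1 ℚ./ length ps

averageℚ-≤-maxℚ : ∀ ps → averageℚ ps ≤ℚ maxℚ ps
averageℚ-≤-maxℚ ps = averageℚ-≤ ps (All.tabulate (maxℚ-upper ps)) (0≤maxℚ ps)

-- The average in expRH is a local function of Defs; it unfolds only once range m is split.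
expRH≡averageℚ : ∀ n m X → expRH n m X ≡ averageℚ (map (λ k → expSH n k X) (range m))
expRH≡averageℚ n m X with range m
... | []    = refl
... | _ ∷ _ = refl

∷-∈-powerset : ∀ l L {T} → T ∈ powerset L → l ∷ T ∈ powerset (l ∷ L)
∷-∈-powerset l L T∈ = ∈-++⁺ˡ (∈-map⁺ (l ∷_) T∈)

∈-powerset-∷ : ∀ l L {T} → T ∈ powerset L → T ∈ powerset (l ∷ L)
∈-powerset-∷ l L T∈ = ∈-++⁺ʳ (map (l ∷_) (powerset L)) T∈

∈-powerset-self : ∀ L → L ∈ powerset L
∈-powerset-self []      = here refl
∈-powerset-self (l ∷ L) = ∷-∈-powerset l L (∈-powerset-self L)

-- R may have repetitions (distinct elements of X can share a residue), hence the count length R.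
powerset-extend : ∀ (L R : List ℕ) n → length R ≤ n → n ≤ length L →
  ∃[ T ] T ∈ powerset L × length T ≡ n × (∀ {r} → r ∈ R → r ∈ L → r ∈ T)
powerset-extend [] R zero _ _ = [] , here refl , refl , λ _ ()
powerset-extend (l ∷ L) R n |R|≤n n≤1+|L| with l ∈? R
powerset-extend (l ∷ L) R zero |R|≤0 _ | yes l∈R
  with () ← subst (_≤ 0) (length-─ l∈R) |R|≤0
powerset-extend (l ∷ L) R (suc n) |R|≤1+n (s≤s n≤|L|) | yes l∈R
  with T , T∈ , |T|≡n , covers ←
         powerset-extend L (R ─ l∈R) n (ℕ.≤-pred (subst (_≤ suc n) (length-─ l∈R) |R|≤1+n)) n≤|L| =
  l ∷ T , ∷-∈-powerset l L T∈ , cong suc |T|≡n , covers′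
  where
  covers′ : ∀ {r} → r ∈ R → r ∈ l ∷ L → r ∈ l ∷ T
  covers′ {r} r∈R r∈lL with r ≟ l | r∈lL
  ... | yes r≡l | _          = here r≡l
  ... | no r≢l  | here r≡l   = contradiction r≡l r≢l
  ... | no r≢l  | there r∈L  = there (covers (∈-─ l∈R r∈R r≢l) r∈L)
powerset-extend (l ∷ L) R n |R|≤n n≤1+|L| | no l∉R with n ℕ.≤? length L
... | yes n≤|L| with T , T∈ , |T|≡n , covers ← powerset-extend L R n |R|≤n n≤|L| =
  T , ∈-powerset-∷ l L T∈ , |T|≡n , covers′
  where
  covers′ : ∀ {r} → r ∈ R → r ∈ l ∷ L → r ∈ T
  covers′ r∈R (here refl) = contradiction r∈R l∉R
  covers′ r∈R (there r∈L) = covers r∈R r∈L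
... | no n≰|L| =
  l ∷ L , ∈-powerset-self (l ∷ L) , ℕ.≤-antisym (ℕ.≰⇒> n≰|L|) n≤1+|L| , λ _ r∈ → r∈

binOf-% : ∀ n k c x → binOf n (suc k) c (x % suc k) ≡ binOf n (suc k) c x
binOf-% n k c x = cong (λ r → n * r / K) (begin
  c * (x % K) % K             ≡⟨ %-distribˡ-* c (x % K) K ⟩
  c % K * (x % K % K) % K     ≡⟨ cong (λ r → c % K * r % K) (m%n%n≡m%n x K) ⟩
  c % K * (x % K) % K         ≡⟨ %-distribˡ-* c x K ⟨
  c * x % K                   ∎)
  where
  open ≡-Reasoning
  K = suc k

load-≤-* : ∀ q n k c {X Y} → Unique X → All (_< q * suc k) X →
  (∀ {x} → x ∈ X → x % suc k ∈ Y) → ∀ b → load n (suc k) c X b ≤ q * load n (suc k) c Y b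
load-≤-* q n k c {X} {Y} uX X<qK X%K⊆Y b = begin
  length Xᵇ                            ≡⟨ length-map divMod Xᵇ ⟨
  length (map divMod Xᵇ)               ≤⟨ Unique-⊆⇒length-≤ (Unique.map⁺ divMod-inj (Unique.filter⁺ inBin? uX)) divMod-⊆ ⟩
  length (cartesianProduct (upTo q) Yᵇ) ≡⟨ length-cartesianProduct (upTo q) Yᵇ ⟩
  length (upTo q) * length Yᵇ          ≡⟨ cong (_* length Yᵇ) (length-upTo q) ⟩
  q * length Yᵇ                        ∎
  where
  open ℕ.≤-Reasoning
  K = suc k
  inBin? = λ x → binOf n K c x ≟ b
  Xᵇ = filter inBin? X
  Yᵇ = filter inBin? Y
  divMod : ℕ → ℕ × ℕ
  divMod x = x / K , x % K
  divMod-inj : ∀ {x y} → divMod x ≡ divMod y → x ≡ y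
  divMod-inj eq = divMod-injective K (cong proj₁ eq) (cong proj₂ eq)
  divMod-⊆ : map divMod Xᵇ ⊆ cartesianProduct (upTo q) Yᵇ
  divMod-⊆ p with x , x∈Xᵇ , refl ← ∈-map⁻ divMod p with x∈X , x∈bin ← ∈-filter⁻ inBin? x∈Xᵇ =
    ∈-cartesianProduct⁺ (∈-upTo⁺ {n = q} (m<n*o⇒m/o<n (All.lookup X<qK x∈X)))
                        (∈-filter⁺ inBin? (X%K⊆Y x∈X) (trans (binOf-% n k c x) x∈bin))

residues⊆subsetOfSize : ∀ n k (X : List ℕ) → length X ≡ n → n ≤ suc k →
  ∃[ Y ] Y ∈ subsetsOfSize (suc k) n × (∀ {x} → x ∈ X → x % suc k ∈ Y)
residues⊆subsetOfSize n k X |X|≡n n≤K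
  with Y , Y∈ , |Y|≡n , covers ← powerset-extend (upTo (suc k)) (map (_% suc k) X) n
         (ℕ.≤-reflexive (trans (length-map (_% suc k) X) |X|≡n))
         (ℕ.≤-trans n≤K (ℕ.≤-reflexive (sym (length-upTo (suc k))))) =
  Y , ∈-filter⁺ (λ s → length s ≟ n) Y∈ |Y|≡n ,
  λ {x} x∈X → covers (∈-map⁺ (_% suc k) x∈X) (∈-upTo⁺ (m%n<n x (suc k)))

expSH≤q*M-SH : ∀ q n k X → Unique X → length X ≡ n → n ≤ suc k → All (_< q * suc k) X →
  expSH n (suc k) X ≤ℚ (+ q ℚ./ 1) *ℚ M-SH (suc k) n
expSH≤q*M-SH q n k X uX |X|≡n n≤K X<qK
  with Y , Y∈subsets , X%K⊆Y ← residues⊆subsetOfSize n k X |X|≡n n≤K = begin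
  expSH n K X                  ≤⟨ avg-≤-* q (map maxloadX (units K)) (map maxloadY (units K)) same-length
                                    (sum-map-≤-* q (units K) maxloadX≤q*maxloadY) ⟩
  (+ q ℚ./ 1) *ℚ expSH n K Y   ≤⟨ ℚ.*-monoˡ-≤-nonNeg (+ q ℚ./ 1) {{ℚ.normalize-nonNeg q 1}}
                                    (maxℚ-upper _ (∈-map⁺ (expSH n K) Y∈subsets)) ⟩
  (+ q ℚ./ 1) *ℚ M-SH K n      ∎
  where
  open ℚ.≤-Reasoning
  K = suc k
  maxloadX maxloadY : ℕ → ℕ
  maxloadX c = maxload n K c X
  maxloadY c = maxload n K c Y
  same-length = trans (length-map maxloadX (units K)) (sym (length-map maxloadY (units K)))
  maxloadX≤q*maxloadY : ∀ c → maxloadX c ≤ q * maxloadY c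
  maxloadX≤q*maxloadY c = maxℕ-map-≤-* q (upTo n) (load-≤-* q n k c uX X<qK X%K⊆Y)

∈-range⁻ : ∀ {m k} → k ∈ range m → m ≤ 2 * k
∈-range⁻ {m} k∈range = proj₂ (∈-filter⁻ (λ k → m ℕ.≤? 2 * k) k∈range)

mainTheorem9 : (n m : ℕ) → 1 ≤ n → 2 * n ≤ m →
    (X : List ℕ) → Unique X → length X ≡ n → All (_< m) X →
    expRH n m X ≤ℚ maxℚ (map (λ k → 2ℚ *ℚ M-SH k n) (range m))
mainTheorem9 n m 1≤n 2n≤m X uX |X|≡n X<m = begin
  expRH n m X                                    ≡⟨ expRH≡averageℚ n m X ⟩
  averageℚ (map (λ k → expSH n k X) (range m))   ≤⟨ averageℚ-≤-maxℚ (map (λ k → expSH n k X) (range m)) ⟩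
  maxℚ (map (λ k → expSH n k X) (range m))       ≤⟨ maxℚ-map-mono (range m) expSH≤2M-SH ⟩
  maxℚ (map (λ k → 2ℚ *ℚ M-SH k n) (range m))    ∎
  where
  open ℚ.≤-Reasoning
  expSH≤2M-SH : ∀ {k} → k ∈ range m → expSH n k X ≤ℚ 2ℚ *ℚ M-SH k n
  expSH≤2M-SH {zero} k∈range
    with () ← ℕ.≤-trans (ℕ.*-monoʳ-≤ 2 1≤n) (ℕ.≤-trans 2n≤m (∈-range⁻ k∈range))
  expSH≤2M-SH {suc k} k∈range =
    expSH≤q*M-SH 2 n k X uX |X|≡n (ℕ.*-cancelˡ-≤ 2 (ℕ.≤-trans 2n≤m m≤2K))
      (All.map (λ x<m → ℕ.<-≤-trans x<m m≤2K) X<m)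
    where m≤2K = ∈-range⁻ k∈range
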